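{- Let $A$ be a principally polarized supersingular abelian variety of dimension $g$ over $K=\mathbb{F}_q$ with $K$-period $M$ and $K$-parity $+1$, and let $A'/K$ be a $K$-twist of $A$ of order $T$ with $K$-period $N$ and $K$-parity $-1$. Let $z_1,\dots,z_g$ and $w_1,\dots,w_g$ be representatives of the conjugate pairs of normalized Weil numbers of $A/K$ and $A'/K$, ordered so that $w_i=\lambda_iz_i$ with $\lambda_i$ a $T$-th root of unity for each $i$, and let $t=\mathrm{lcm}\{o(\lambda_i):1\le i\le g\}$, where $o$ denotes multiplicative order. Put $e_M=\mathrm{ord}_2(M)$, $e_N=\mathrm{ord}_2(N)$. If $e_N\le e_M$ then $\mathrm{ord}_2(t)=1+e_M$; if $e_N>e_M$ then $\mathrm{ord}_2(t)=e_N$.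
   Context: Normalized Weil numbers of $B/K$: $\alpha/\sqrt q$ for the roots $\alpha$ of the characteristic polynomial of Frobenius, in conjugate pairs $z_i,\bar z_i$; they are roots of unity for supersingular $B$. The $K$-period is the smallest $m\ge1$ such that $q^m$ is a square and either (i) $z_i^m=-1$ for all $i$ or (ii) $z_i^m=1$ for all $i$; $K$-parity $1$ in case (i), $-1$ in case (ii). A $K$-twist of $A$ is a principally polarized $A'/K$ with $A\times_K\overline{\mathbb{F}}_p\cong A'\times_K\overline{\mathbb{F}}_p$ as polarized varieties; its order $T$ is the smallest $m$ with an isomorphism over the degree-$m$ extension of $K$. (Since $A,A'$ are isomorphic over $\mathbb{F}_{q^T}$, the normalized Weil numbers can be ordered so that $z_i^T=w_i^T$.) -}

module Defs where

open import Data.Nat using (ℕ; zero; suc; _*_; _^_; _≤_; _<_)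
open import Data.Nat.Divisibility using (_∣_)
open import Data.Nat.LCM using (lcm)
open import Data.Nat.Primality using (Prime)
open import Data.Integer using (ℤ; +_)
open import Data.Rational using (ℚ; _/_; _+_; _-_; ½)
import Data.Rational as Q
open import Data.Fin using (Fin)
open import Data.Vec.Functional using (Vector; foldr)
open import Data.Product using (Σ; _×_)
open import Data.Sum using (_⊎_)
open import Relation.Nullary using (¬_)
open import Relation.Binary.PropositionalEquality using (_≡_)

-- Roots of unity in ℂ are encoded by their "exponent" in ℚ/ℤ:
-- the rational x stands for exp(2πi x).  Multiplication of roots of
-- unity is addition of exponents, z^m is m·x, and -1 is ½.

RootOfUnity : Set
RootOfUnity = ℚ

IsInt : ℚ → Set
IsInt x = Σ ℤ (λ k → x ≡ k / 1)

_≈_ : RootOfUnity → RootOfUnity → Set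
x ≈ y = IsInt (x - y)

one : RootOfUnity
one = + 0 / 1

minusOne : RootOfUnity
minusOne = ½

_·_ : RootOfUnity → RootOfUnity → RootOfUnity
x · y = x + y

_^^_ : RootOfUnity → ℕ → RootOfUnity
x ^^ m = (+ m / 1) Q.* x

IsSquare : ℕ → Set
IsSquare n = Σ ℕ (λ s → s * s ≡ n)

IsPrimePower : ℕ → Set
IsPrimePower q = Σ ℕ (λ p → Σ ℕ (λ r → Prime p × 1 ≤ r × q ≡ p ^ r))

-- case (i) / case (ii) of the K-period definition, for the list
-- z_1..z_g of representatives of the conjugate pairs of normalized
-- Weil numbers (conjugation preserves z^m = ±1, so representatives suffice)
CaseI : ∀ {g} → Vector RootOfUnity g → ℕ → Set
CaseI zs m = ∀ i → (zs i ^^ m) ≈ minusOne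

CaseII : ∀ {g} → Vector RootOfUnity g → ℕ → Set
CaseII zs m = ∀ i → (zs i ^^ m) ≈ one

Admissible : ∀ {g} → ℕ → Vector RootOfUnity g → ℕ → Set
Admissible q zs m = 1 ≤ m × IsSquare (q ^ m) × (CaseI zs m ⊎ CaseII zs m)

IsKPeriod : ∀ {g} → ℕ → Vector RootOfUnity g → ℕ → Set
IsKPeriod q zs m = Admissible q zs m × (∀ k → 1 ≤ k → k < m → ¬ Admissible q zs k)

KParityPlus : ∀ {g} → Vector RootOfUnity g → ℕ → Set
KParityPlus zs m = CaseI zs m

KParityMinus : ∀ {g} → Vector RootOfUnity g → ℕ → Set
KParityMinus zs m = CaseII zs m × ¬ CaseI zs m

IsOrder : RootOfUnity → ℕ → Set
IsOrder x k = 1 ≤ k × (x ^^ k) ≈ one × (∀ j → 1 ≤ j → j < k → ¬ ((x ^^ j) ≈ one))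

IsOrd2 : ℕ → ℕ → Set
IsOrd2 n e = (2 ^ e) ∣ n × ¬ ((2 ^ suc e) ∣ n)

lcmAll : ∀ {g} → Vector ℕ g → ℕ
lcmAll os = foldr lcm 1 os

{-# OPTIONS --safe #-}
module Submission where

-- Write M = 2^eM·m and N = 2^eN·n with m, n odd, and c = m·n.  Since w_i = λ_i z_i,
-- λ_i^K = 1 as soon as w_i^K = z_i^K = 1, so t divides 2^k·c whenever 2^k is a
-- multiple of 2^eN and of 2^(1+eM).  Hence ord₂ t is pinned down by showing that t
-- does not divide 2^f·c for f = eM (resp. f = eN − 1).  For eN ≤ eM, t ∣ 2^eM·c
-- would force w_i^(2^eM·c) = z_i^(2^eM·c), i.e. 1 = −1.  For eN > eM it would force
-- w_i^(N/2) = z_i^(2^f·c) = ±1 for all i, so N/2 would already satisfy the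
-- definition of the K-period of A′ (q^(N/2) is a square because q^M is one and
-- 2^eM divides N/2), contradicting the minimality of N.

open import Defs
open import Data.Nat using (ℕ; zero; suc; _+_; _*_; _^_; _≤_; _<_; _>_; z≤n; s≤s; _≟_)
open import Data.Nat.Properties
open import Data.Nat.Divisibility
open import Data.Nat.DivMod using (_%_; _/_; m≡m%n+[m/n]*n; m%n<n)
open import Data.Nat.LCM using (m∣lcm[m,n]; n∣lcm[m,n]; lcm-least)
open import Data.Nat.Primality using (Prime; euclidsLemma; prime[2]; prime⇒nonZero; ¬prime[1])
import Data.Nat.Coprimality as Coprime
open import Data.Nat.Solver using (module +-*-Solver)
open import Data.Integer as ℤ using (ℤ; +_)
import Data.Integer.Properties as ℤP
open import Data.Rational as ℚ using (ℚ; mkℚ; ½)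
import Data.Rational.Properties as ℚP
import Data.Rational.Solver as ℚ-Solver
open import Data.Fin using (zero; suc)
open import Data.Vec.Functional using (Vector; tail)
open import Data.Product using (Σ; ∃; _×_; _,_)
open import Data.Sum using (_⊎_; inj₁; inj₂; reduce; map)
open import Data.Empty using (⊥-elim)
open import Level using (0ℓ)
open import Relation.Nullary using (¬_; yes; no)
open import Relation.Binary.Bundles using (Setoid)
open import Relation.Binary.PropositionalEquality
import Relation.Binary.Reasoning.Setoid as SetoidReasoning

-- Roots of unity as exponents modulo ℤ

ι : ℤ → ℚ
ι k = k ℚ./ 1

ι≡mkℚ : ∀ k → ι k ≡ mkℚ k 0 (Coprime.sym (Coprime.1-coprimeTo _))
ι≡mkℚ k = ℚP.↥p/↧p≡p (mkℚ k 0 (Coprime.sym (Coprime.1-coprimeTo _)))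

ι-+ : ∀ a b → ι a ℚ.+ ι b ≡ ι (a ℤ.+ b)
ι-+ a b rewrite ι≡mkℚ a | ι≡mkℚ b =
  cong₂ (λ u v → (u ℤ.+ v) ℚ./ 1) (ℤP.*-identityʳ a) (ℤP.*-identityʳ b)

ι-* : ∀ a b → ι a ℚ.* ι b ≡ ι (a ℤ.* b)
ι-* a b rewrite ι≡mkℚ a | ι≡mkℚ b = refl

IsInt-subst : ∀ {x y} → x ≡ y → IsInt x → IsInt y
IsInt-subst refl p = p

IsInt-+ : ∀ {x y} → IsInt x → IsInt y → IsInt (x ℚ.+ y)
IsInt-+ (a , refl) (b , refl) = a ℤ.+ b , ι-+ a b

IsInt-neg : ∀ {x} → IsInt x → IsInt (ℚ.- x)
IsInt-neg (a , refl) = ℤ.-1ℤ ℤ.* a , (begin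
  ℚ.- ι a                 ≡⟨ cong ℚ.-_ (ℚP.*-identityˡ (ι a)) ⟨
  ℚ.- (ι (+ 1) ℚ.* ι a)   ≡⟨ ℚP.neg-distribˡ-* (ι (+ 1)) (ι a) ⟩
  ι ℤ.-1ℤ ℚ.* ι a         ≡⟨ ι-* ℤ.-1ℤ a ⟩
  ι (ℤ.-1ℤ ℤ.* a)         ∎)
  where open ≡-Reasoning

IsInt-^^ : ∀ {x} m → IsInt x → IsInt (x ^^ m)
IsInt-^^ m (a , refl) = + m ℤ.* a , ι-* (+ m) a

¬IsInt-½ : ¬ IsInt ½
¬IsInt-½ (k , ½≡k) with cong ℚ.↧ₙ_ (trans ½≡k (ι≡mkℚ k))
... | ()

module _ where
  open ℚ-Solver.+-*-Solver

  ≈-refl : ∀ {x} → x ≈ x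
  ≈-refl {x} = + 0 , ℚP.+-inverseʳ x

  ≈-sym : ∀ {x y} → x ≈ y → y ≈ x
  ≈-sym {x} {y} p = IsInt-subst (solve 2 (λ x y → :- (x :- y) := y :- x) refl x y) (IsInt-neg p)

  ≈-trans : ∀ {x y z} → x ≈ y → y ≈ z → x ≈ z
  ≈-trans {x} {y} {z} p q =
    IsInt-subst (solve 3 (λ x y z → (x :- y) :+ (y :- z) := x :- z) refl x y z) (IsInt-+ p q)

  -- _≈_ does not determine its arguments, so congruences take the roots explicitly.
  ·-congˡ : ∀ x y y′ → y ≈ y′ → (x · y) ≈ (x · y′)
  ·-congˡ x y y′ = IsInt-subst (solve 3 (λ x y y′ → y :- y′ := (x :+ y) :- (x :+ y′)) refl x y y′)

  ·-congʳ : ∀ x x′ y → x ≈ x′ → (x · y) ≈ (x′ · y)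
  ·-congʳ x x′ y = IsInt-subst (solve 3 (λ x x′ y → x :- x′ := (x :+ y) :- (x′ :+ y)) refl x x′ y)

  ^^-cong : ∀ m x y → x ≈ y → (x ^^ m) ≈ (y ^^ m)
  ^^-cong m x y p =
    IsInt-subst (solve 3 (λ k x y → k :* (x :- y) := k :* x :- k :* y) refl (ι (+ m)) x y) (IsInt-^^ m p)

≈-setoid : Setoid 0ℓ 0ℓ
≈-setoid = record
  { Carrier       = RootOfUnity
  ; _≈_           = _≈_
  ; isEquivalence = record
    { refl  = λ {x} → ≈-refl {x}
    ; sym   = λ {x} {y} → ≈-sym {x} {y}
    ; trans = λ {x} {y} {z} → ≈-trans {x} {y} {z}
    }
  }

minusOne≉one : ¬ minusOne ≈ one
minusOne≉one = ¬IsInt-½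

minusOne^^2≈one : (minusOne ^^ 2) ≈ one
minusOne^^2≈one = + 1 , refl

·-identityˡ : ∀ x → (one · x) ≡ x
·-identityˡ = ℚP.+-identityˡ

·-identityʳ : ∀ x → (x · one) ≡ x
·-identityʳ = ℚP.+-identityʳ

one^^ : ∀ m → one ^^ m ≡ one
one^^ m = ℚP.*-zeroʳ (ι (+ m))

^^-distrib-· : ∀ x y m → (x · y) ^^ m ≡ (x ^^ m) · (y ^^ m)
^^-distrib-· x y m = ℚP.*-distribˡ-+ (ι (+ m)) x y

^^-+ : ∀ x a b → x ^^ (a + b) ≡ (x ^^ a) · (x ^^ b)
^^-+ x a b = begin
  ι (+ (a + b)) ℚ.* x           ≡⟨ cong (λ k → ι k ℚ.* x) (ℤP.pos-+ a b) ⟩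
  ι (+ a ℤ.+ + b) ℚ.* x         ≡⟨ cong (ℚ._* x) (ι-+ (+ a) (+ b)) ⟨
  (ι (+ a) ℚ.+ ι (+ b)) ℚ.* x   ≡⟨ ℚP.*-distribʳ-+ x (ι (+ a)) (ι (+ b)) ⟩
  (x ^^ a) · (x ^^ b)           ∎
  where open ≡-Reasoning

^^-* : ∀ x a b → x ^^ (a * b) ≡ (x ^^ b) ^^ a
^^-* x a b = begin
  ι (+ (a * b)) ℚ.* x           ≡⟨ cong (λ k → ι k ℚ.* x) (ℤP.pos-* a b) ⟩
  ι (+ a ℤ.* + b) ℚ.* x         ≡⟨ cong (ℚ._* x) (ι-* (+ a) (+ b)) ⟨
  (ι (+ a) ℚ.* ι (+ b)) ℚ.* x   ≡⟨ ℚP.*-assoc (ι (+ a)) (ι (+ b)) x ⟩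
  (x ^^ b) ^^ a                 ∎
  where open ≡-Reasoning

^^-one-∣ : ∀ {x a b} → (x ^^ a) ≈ one → a ∣ b → (x ^^ b) ≈ one
^^-one-∣ {x} {a} x^a≈1 (divides k refl) = begin
  x ^^ (k * a)   ≡⟨ ^^-* x k a ⟩
  (x ^^ a) ^^ k  ≈⟨ ^^-cong k (x ^^ a) one x^a≈1 ⟩
  one ^^ k       ≡⟨ one^^ k ⟩
  one            ∎
  where open SetoidReasoning ≈-setoid

^^-double : ∀ {x} a → (x ^^ a) ≈ minusOne → (x ^^ (2 * a)) ≈ one
^^-double {x} a x^a≈-1 = begin
  x ^^ (2 * a)    ≡⟨ ^^-* x 2 a ⟩
  (x ^^ a) ^^ 2   ≈⟨ ^^-cong 2 (x ^^ a) minusOne x^a≈-1 ⟩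
  minusOne ^^ 2   ≈⟨ minusOne^^2≈one ⟩
  one             ∎
  where open SetoidReasoning ≈-setoid

^^-odd-multiple : ∀ {x} a j → (x ^^ (2 * a)) ≈ one → (x ^^ (suc (j * 2) * a)) ≈ (x ^^ a)
^^-odd-multiple {x} a j x^2a≈1 = begin
  x ^^ (a + j * 2 * a)             ≡⟨ ^^-+ x a (j * 2 * a) ⟩
  (x ^^ a) · (x ^^ (j * 2 * a))    ≈⟨ ·-congˡ (x ^^ a) _ one (^^-one-∣ x^2a≈1 (divides j (*-assoc j 2 a))) ⟩
  (x ^^ a) · one                   ≡⟨ ·-identityʳ (x ^^ a) ⟩
  x ^^ a                           ∎
  where open SetoidReasoning ≈-setoid

IsOrder⇒∣ : ∀ {x o m} → IsOrder x o → (x ^^ m) ≈ one → o ∣ m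
IsOrder⇒∣ {x} {suc o} {m} (_ , x^o≈1 , minimal) x^m≈1 with m % suc o ≟ 0
... | yes r≡0 = m%n≡0⇒n∣m m (suc o) r≡0
... | no r≢0 = ⊥-elim (minimal r (n≢0⇒n>0 r≢0) (m%n<n m (suc o)) x^r≈1)
  where
  r = m % suc o
  k = m / suc o * suc o
  x^r≈1 : (x ^^ r) ≈ one
  x^r≈1 = begin
    x ^^ r               ≡⟨ ·-identityʳ (x ^^ r) ⟨
    (x ^^ r) · one       ≈⟨ ·-congˡ (x ^^ r) (x ^^ k) one (^^-one-∣ x^o≈1 (divides (m / suc o) refl)) ⟨
    (x ^^ r) · (x ^^ k)  ≡⟨ ^^-+ x r k ⟨
    x ^^ (r + k)         ≡⟨ cong (x ^^_) (m≡m%n+[m/n]*n m (suc o)) ⟨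
    x ^^ m               ≈⟨ x^m≈1 ⟩
    one                  ∎
    where open SetoidReasoning ≈-setoid

-- Divisibility and 2-adic valuations

module _ where
  open +-*-Solver

  odd-part : ∀ {n e} → IsOrd2 n e → Σ ℕ λ m → n ≡ 2 ^ e * m × ¬ 2 ∣ m
  odd-part {n} {e} (divides m n≡m*2^e , 2^[1+e]∤n) = m , trans n≡m*2^e (*-comm m (2 ^ e)) , m-odd
    where
    m-odd : ¬ 2 ∣ m
    m-odd (divides k refl) = 2^[1+e]∤n (divides k (trans n≡m*2^e (*-assoc k 2 (2 ^ e))))

  odd⇒≡1+2* : ∀ {k} → ¬ 2 ∣ k → ∃ λ j → k ≡ suc (j * 2)
  odd⇒≡1+2* {k} k-odd = k / 2 , trans (m≡m%n+[m/n]*n k 2) (cong (_+ k / 2 * 2) k%2≡1)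
    where
    k%2≡1 : k % 2 ≡ 1
    k%2≡1 with k % 2 | m%n<n k 2 | m%n≡0⇒n∣m k 2
    ... | zero        | _            | 2∣k = ⊥-elim (k-odd (2∣k refl))
    ... | suc zero    | _            | _   = refl
    ... | suc (suc _) | s≤s (s≤s ()) | _

  odd⇒>0 : ∀ {k} → ¬ 2 ∣ k → 1 ≤ k
  odd⇒>0 {zero}  k-odd = ⊥-elim (k-odd (2 ∣0))
  odd⇒>0 {suc _} _     = s≤s z≤n

  odd-* : ∀ {a b} → ¬ 2 ∣ a → ¬ 2 ∣ b → ¬ 2 ∣ a * b
  odd-* {a} {b} a-odd b-odd 2∣ab with euclidsLemma a b prime[2] 2∣ab
  ... | inj₁ 2∣a = a-odd 2∣a
  ... | inj₂ 2∣b = b-odd 2∣b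

  ^-monoʳ-∣ : ∀ b {m n} → m ≤ n → b ^ m ∣ b ^ n
  ^-monoʳ-∣ b {n = n} z≤n       = 1∣ (b ^ n)
  ^-monoʳ-∣ b         (s≤s m≤n) = *-monoʳ-∣ b (^-monoʳ-∣ b m≤n)

  prime^∣-cancelˡ : ∀ {p m n} e → Prime p → ¬ p ∣ m → p ^ e ∣ m * n → p ^ e ∣ n
  prime^∣-cancelˡ {n = n} zero _ _ _ = 1∣ n
  prime^∣-cancelˡ {p} {m} {n} (suc e) pr p∤m p^[1+e]∣mn
    with euclidsLemma m n pr (∣-trans (m∣m*n (p ^ e)) p^[1+e]∣mn)
  ... | inj₁ p∣m = ⊥-elim (p∤m p∣m)
  ... | inj₂ (divides k refl) =
    subst (p ^ suc e ∣_) (*-comm p k) (*-monoʳ-∣ p (prime^∣-cancelˡ e pr p∤m p^e∣mk))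
    where
    instance _ = prime⇒nonZero pr
    p^e∣mk : p ^ e ∣ m * k
    p^e∣mk = *-cancelˡ-∣ p (subst (p ^ suc e ∣_)
      (solve 3 (λ m k p → m :* (k :* p) := p :* (m :* k)) refl m k p) p^[1+e]∣mn)

  IsOrd2-of-∣-∤ : ∀ {L c} f → ¬ 2 ∣ c → L ∣ 2 ^ suc f * c → ¬ L ∣ 2 ^ f * c → IsOrd2 L (suc f)
  IsOrd2-of-∣-∤ {L} {c} f c-odd L∣2^[1+f]c@(divides d 2^[1+f]c≡dL) L∤2^fc = 2^[1+f]∣L , 2^[2+f]∤L
    where
    instance _ = m^n≢0 2 (suc f)
    2^[1+f]∣L : 2 ^ suc f ∣ L
    2^[1+f]∣L with 2 ∣? d
    ... | no d-odd = prime^∣-cancelˡ (suc f) prime[2] d-odd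
                       (divides c (trans (sym 2^[1+f]c≡dL) (*-comm (2 ^ suc f) c)))
    ... | yes (divides d′ refl) = ⊥-elim (L∤2^fc (divides d′ (*-cancelˡ-≡ _ _ 2 (begin
        2 * (2 ^ f * c)  ≡⟨ *-assoc 2 (2 ^ f) c ⟨
        2 ^ suc f * c    ≡⟨ 2^[1+f]c≡dL ⟩
        d′ * 2 * L       ≡⟨ solve 2 (λ d′ L → d′ :* con 2 :* L := con 2 :* (d′ :* L)) refl d′ L ⟩
        2 * (d′ * L)     ∎))))
      where open ≡-Reasoning
    2^[2+f]∤L : ¬ 2 ^ suc (suc f) ∣ L
    2^[2+f]∤L 2^[2+f]∣L = c-odd (*-cancelˡ-∣ (2 ^ suc f)
      (subst (_∣ 2 ^ suc f * c) (*-comm 2 (2 ^ suc f)) (∣-trans 2^[2+f]∣L L∣2^[1+f]c)))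

  prime-square-descent : ∀ {p} → Prime p → ∀ k s → p ^ suc k ≡ s * s → ∃ λ t → p ^ k ≡ p * (t * t)
  prime-square-descent {p} pr k s p^[1+k]≡ss = descend p∣s
    where
    instance _ = prime⇒nonZero pr
    p∣s : p ∣ s
    p∣s = reduce (euclidsLemma s s pr (divides (p ^ k) (trans (sym p^[1+k]≡ss) (*-comm p (p ^ k)))))
    descend : p ∣ s → ∃ λ t → p ^ k ≡ p * (t * t)
    descend (divides t refl) = t , *-cancelˡ-≡ _ _ p (trans p^[1+k]≡ss
      (solve 2 (λ t p → t :* p :* (t :* p) := p :* (p :* (t :* t))) refl t p))

  even-exponent : ∀ {p} → Prime p → ∀ k s → p ^ k ≡ s * s → 2 ∣ k
  even-exponent pr zero s _ = divides 0 refl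
  even-exponent {p} pr (suc zero) s p≡ss with prime-square-descent pr 0 s p≡ss
  ... | t , 1≡ptt = ⊥-elim (¬prime[1] (subst Prime (∣1⇒≡1 p∣1) pr))
    where
    p∣1 : p ∣ 1
    p∣1 = divides (t * t) (trans 1≡ptt (*-comm p (t * t)))
  even-exponent {p} pr (suc (suc k)) s p^[2+k]≡ss with prime-square-descent pr (suc k) s p^[2+k]≡ss
  ... | t , p^[1+k]≡ptt with even-exponent pr k t (*-cancelˡ-≡ _ _ p p^[1+k]≡ptt)
    where instance _ = prime⇒nonZero pr
  ...   | divides j refl = divides (suc j) refl

  IsSquare-^ : ∀ {q e m n} → IsPrimePower q → IsSquare (q ^ (2 ^ e * m)) → ¬ 2 ∣ m → 2 ^ e ∣ n →
               IsSquare (q ^ n)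
  IsSquare-^ {e = e} {m} (p , r , pr , _ , refl) (s , ss≡q^[2^e*m]) m-odd (divides k refl) =
    square (∣n⇒∣m*n k 2∣r*2^e)
    where
    2∣r*[2^e*m] : 2 ∣ r * (2 ^ e * m)
    2∣r*[2^e*m] = even-exponent pr _ s (trans (sym (^-*-assoc p r (2 ^ e * m))) (sym ss≡q^[2^e*m]))
    2∣r*2^e : 2 ∣ r * 2 ^ e
    2∣r*2^e with euclidsLemma (r * 2 ^ e) m prime[2] (subst (2 ∣_) (sym (*-assoc r (2 ^ e) m)) 2∣r*[2^e*m])
    ... | inj₁ 2∣r*2^e = 2∣r*2^e
    ... | inj₂ 2∣m     = ⊥-elim (m-odd 2∣m)
    square : 2 ∣ k * (r * 2 ^ e) → IsSquare ((p ^ r) ^ (k * 2 ^ e))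
    square (divides h k*r*2^e≡h*2) = p ^ h , (begin
      p ^ h * p ^ h          ≡⟨ ^-distribˡ-+-* p h h ⟨
      p ^ (h + h)            ≡⟨ cong (p ^_) (solve 1 (λ h → h :+ h := h :* con 2) refl h) ⟩
      p ^ (h * 2)            ≡⟨ cong (p ^_) k*r*2^e≡h*2 ⟨
      p ^ (k * (r * 2 ^ e))  ≡⟨ cong (p ^_) (solve 3 (λ k r P → k :* (r :* P) := r :* (k :* P)) refl k r (2 ^ e)) ⟩
      p ^ (r * (k * 2 ^ e))  ≡⟨ ^-*-assoc p r (k * 2 ^ e) ⟨
      (p ^ r) ^ (k * 2 ^ e)  ∎)
      where open ≡-Reasoning

lcmAll-least : ∀ {g} (os : Vector ℕ g) {k} → (∀ i → os i ∣ k) → lcmAll os ∣ k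
lcmAll-least {zero}  os {k} _      = 1∣ k
lcmAll-least {suc g} os     os∣k = lcm-least (os∣k zero) (lcmAll-least (tail os) (λ i → os∣k (suc i)))

∣-lcmAll : ∀ {g} (os : Vector ℕ g) i → os i ∣ lcmAll os
∣-lcmAll {suc g} os zero    = m∣lcm[m,n] (os zero) (lcmAll (tail os))
∣-lcmAll {suc g} os (suc i) = ∣-trans (∣-lcmAll (tail os) i) (n∣lcm[m,n] (os zero) (lcmAll (tail os)))

module Twist {g} (eM m n N : ℕ) (z w λs : Vector RootOfUnity g) (os : Vector ℕ g)
  (m-odd : ¬ 2 ∣ m) (n-odd : ¬ 2 ∣ n)
  (z-parity : CaseI z (2 ^ eM * m)) (w-parity : CaseII w N)
  (twist : ∀ i → w i ≈ (λs i · z i)) (orders : ∀ i → IsOrder (λs i) (os i))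
  where

  M c L : ℕ
  M = 2 ^ eM * m
  c = m * n
  L = lcmAll os

  c-odd : ¬ 2 ∣ c
  c-odd = odd-* m-odd n-odd

  z^^≈one : ∀ {k} → suc eM ≤ k → ∀ i → (z i ^^ (2 ^ k * c)) ≈ one
  z^^≈one {k} 1+eM≤k i = ^^-one-∣ (^^-double M (z-parity i)) 2M∣2^kc
    where
    2M∣2^kc : 2 * M ∣ 2 ^ k * c
    2M∣2^kc = subst (_∣ 2 ^ k * c) (*-assoc 2 (2 ^ eM) m) (*-pres-∣ (^-monoʳ-∣ 2 1+eM≤k) (m∣m*n n))

  z^^≈minusOne : ∀ i → (z i ^^ (2 ^ eM * c)) ≈ minusOne
  z^^≈minusOne i with odd⇒≡1+2* n-odd
  ... | j , refl = begin
    z i ^^ (2 ^ eM * c)  ≡⟨ cong (z i ^^_) (solve 3 (λ P m n → P :* (m :* n) := n :* (P :* m)) refl (2 ^ eM) m n) ⟩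
    z i ^^ (n * M)       ≈⟨ ^^-odd-multiple M j (^^-double M (z-parity i)) ⟩
    z i ^^ M             ≈⟨ z-parity i ⟩
    minusOne             ∎
    where
    open SetoidReasoning ≈-setoid
    open +-*-Solver

  twist-^^ : ∀ i k → (λs i ^^ k) ≈ one → (w i ^^ k) ≈ (z i ^^ k)
  twist-^^ i k λ^k≈1 = begin
    w i ^^ k                     ≈⟨ ^^-cong k (w i) (λs i · z i) (twist i) ⟩
    (λs i · z i) ^^ k            ≡⟨ ^^-distrib-· (λs i) (z i) k ⟩
    (λs i ^^ k) · (z i ^^ k)     ≈⟨ ·-congʳ (λs i ^^ k) one (z i ^^ k) λ^k≈1 ⟩
    one · (z i ^^ k)             ≡⟨ ·-identityˡ (z i ^^ k) ⟩
    z i ^^ k                     ∎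
    where open SetoidReasoning ≈-setoid


  order∣ : ∀ i {k} → (w i ^^ k) ≈ one → (z i ^^ k) ≈ one → os i ∣ k
  order∣ i {k} w^k≈1 z^k≈1 = IsOrder⇒∣ (orders i) (begin
    λs i ^^ k                  ≡⟨ ·-identityʳ (λs i ^^ k) ⟨
    (λs i ^^ k) · one          ≈⟨ ·-congˡ (λs i ^^ k) (z i ^^ k) one z^k≈1 ⟨
    (λs i ^^ k) · (z i ^^ k)   ≡⟨ ^^-distrib-· (λs i) (z i) k ⟨
    (λs i · z i) ^^ k          ≈⟨ ^^-cong k (w i) (λs i · z i) (twist i) ⟨
    w i ^^ k                   ≈⟨ w^k≈1 ⟩
    one                        ∎)
    where open SetoidReasoning ≈-setoid

  N∣2^kc : ∀ {e k} → N ≡ 2 ^ e * n → e ≤ k → N ∣ 2 ^ k * c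
  N∣2^kc {e} {k} N≡ e≤k = subst (_∣ 2 ^ k * c) (sym N≡) (*-pres-∣ (^-monoʳ-∣ 2 e≤k) (n∣m*n m))

  lcm∣2^kc : ∀ {e k} → N ≡ 2 ^ e * n → e ≤ k → suc eM ≤ k → L ∣ 2 ^ k * c
  lcm∣2^kc N≡ e≤k 1+eM≤k =
    lcmAll-least os (λ i → order∣ i (^^-one-∣ (w-parity i) (N∣2^kc N≡ e≤k)) (z^^≈one 1+eM≤k i))

  ∣lcm⇒w^^≈z^^ : ∀ {k} → L ∣ k → ∀ i → (w i ^^ k) ≈ (z i ^^ k)
  ∣lcm⇒w^^≈z^^ {k} L∣k i with orders i
  ... | _ , λ^o≈1 , _ = twist-^^ i k (^^-one-∣ λ^o≈1 (∣-trans (∣-lcmAll os i) L∣k))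

  IsOrd2-lcm-below : ∀ {e} → N ≡ 2 ^ e * n → e ≤ eM → ¬ CaseI w N → IsOrd2 L (suc eM)
  IsOrd2-lcm-below N≡ e≤eM ¬caseI =
    IsOrd2-of-∣-∤ eM c-odd (lcm∣2^kc N≡ (m≤n⇒m≤1+n e≤eM) ≤-refl) L∤2^eMc
    where
    X = 2 ^ eM * c
    L∤2^eMc : ¬ L ∣ X
    L∤2^eMc L∣X = ¬caseI (λ i → ⊥-elim (minusOne≉one (begin
      minusOne   ≈⟨ z^^≈minusOne i ⟨
      z i ^^ X   ≈⟨ ∣lcm⇒w^^≈z^^ L∣X i ⟨
      w i ^^ X   ≈⟨ ^^-one-∣ (w-parity i) (N∣2^kc N≡ e≤eM) ⟩
      one        ∎)))
      where open SetoidReasoning ≈-setoid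

  IsOrd2-lcm-above : ∀ {e} q → N ≡ 2 ^ e * n → eM < e → IsPrimePower q → IsSquare (q ^ M) →
                     (∀ k → 1 ≤ k → k < N → ¬ Admissible q w k) → IsOrd2 L e
  IsOrd2-lcm-above {suc f} q N≡ (s≤s eM≤f) q-prime-power q^M-square N-minimal =
    IsOrd2-of-∣-∤ f c-odd (lcm∣2^kc N≡ ≤-refl (s≤s eM≤f)) L∤2^fc
    where
    Y = 2 ^ f * n
    X = 2 ^ f * c
    N≡2Y : N ≡ 2 * Y
    N≡2Y = trans N≡ (*-assoc 2 (2 ^ f) n)
    1≤Y : 1 ≤ Y
    1≤Y = *-mono-≤ (m^n>0 2 f) (odd⇒>0 n-odd)
    Y<N : Y < N
    Y<N = subst (Y <_) (trans (cong (_+_ Y) (sym (+-identityʳ Y))) (sym N≡2Y)) (m<m+n Y 1≤Y)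
    q^Y-square : IsSquare (q ^ Y)
    q^Y-square = IsSquare-^ {e = eM} q-prime-power q^M-square m-odd (∣m⇒∣m*n n (^-monoʳ-∣ 2 eM≤f))
    z-sign : CaseI z X ⊎ CaseII z X
    z-sign with m≤n⇒m<n∨m≡n eM≤f
    ... | inj₁ eM<f = inj₂ (z^^≈one eM<f)
    ... | inj₂ refl = inj₁ z^^≈minusOne
    w^^Y≈z^^X : L ∣ X → ∀ i → (w i ^^ Y) ≈ (z i ^^ X)
    w^^Y≈z^^X L∣X i with odd⇒≡1+2* m-odd
    ... | j , refl = begin
      w i ^^ Y        ≈⟨ ^^-odd-multiple Y j (subst (λ k → (w i ^^ k) ≈ one) N≡2Y (w-parity i)) ⟨
      w i ^^ (m * Y)  ≡⟨ cong (w i ^^_) (solve 3 (λ m P n → m :* (P :* n) := P :* (m :* n)) refl m (2 ^ f) n) ⟩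
      w i ^^ X        ≈⟨ ∣lcm⇒w^^≈z^^ L∣X i ⟩
      z i ^^ X        ∎
      where
      open SetoidReasoning ≈-setoid
      open +-*-Solver
    L∤2^fc : ¬ L ∣ X
    L∤2^fc L∣X = N-minimal Y 1≤Y Y<N (1≤Y , q^Y-square , map
      (λ caseI i → ≈-trans {w i ^^ Y} {z i ^^ X} {minusOne} (w^^Y≈z^^X L∣X i) (caseI i))
      (λ caseII i → ≈-trans {w i ^^ Y} {z i ^^ X} {one} (w^^Y≈z^^X L∣X i) (caseII i))
      z-sign)

proposition4p12 :
    (q g M N T eM eN : ℕ) → IsPrimePower q →
    (z w λs : Vector RootOfUnity g) →
    IsKPeriod q z M → KParityPlus z M →
    IsKPeriod q w N → KParityMinus w N →
    1 ≤ T →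
    (∀ i → (w i) ≈ (λs i · z i)) →
    (∀ i → (λs i ^^ T) ≈ one) →
    (os : Vector ℕ g) → (∀ i → IsOrder (λs i) (os i)) →
    IsOrd2 M eM → IsOrd2 N eN →
    (eN ≤ eM → IsOrd2 (lcmAll os) (suc eM)) ×
    (eN > eM → IsOrd2 (lcmAll os) eN)
proposition4p12 q g M N T eM eN q-prime-power z w λs ((_ , q^M-square , _) , _) z-parity
  (_ , N-minimal) (w-parity , ¬w-caseI) _ twist _ os orders ord₂M ord₂N
  with odd-part {M} {eM} ord₂M | odd-part {N} {eN} ord₂N
... | m , refl , m-odd | n , N≡ , n-odd =
  (λ eN≤eM → IsOrd2-lcm-below N≡ eN≤eM ¬w-caseI) ,
  (λ eM<eN → IsOrd2-lcm-above q N≡ eM<eN q-prime-power q^M-square N-minimal)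
  where open Twist eM m n N z w λs os m-odd n-odd z-parity w-parity twist orders
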